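{- Let $n\ge2$, $c$ a Coxeter element of $\widehat{\mathfrak S}_n$ and $i,j\in\{0,\dots,n-1\}$ distinct. Then $$\omega_c(\beta_{(i,j)},\delta)=2(-1)^{\delta_{i>j}}\big(\delta_{i\in\overline{R_c}}-\delta_{j\in\overline{R_c}}\big).$$
   Context: $\widehat{\mathfrak S}_n$: bijections $w$ of $\mathbb Z$ with $w(k+n)=w(k)+n$, $\sum_{k=1}^nw(k)=\sum_{k=1}^nk$, with simple generators $s_i$ ($0\le i\le n-1$) exchanging $i+mn$ and $i+1+mn$ for all $m$. A Coxeter element $c$ is a product of all $s_i$ once each; $\overline{L_c}=\{x\in\mathbb Z:c(x)>x\}$, $\overline{R_c}=\{x:c(x)<x\}$. $V$ has basis $\alpha_0,\dots,\alpha_{n-1}$ and $\delta=\alpha_0+\dots+\alpha_{n-1}$; $\omega_c$ is the skew-symmetric bilinear form with $\omega_c(\alpha_i,\alpha_j)=\pm1$ when $j-i\equiv\pm1\pmod n$, with sign $+$ iff $s_i$ appears before $s_j$ in a reduced word of $c$, and $0$ otherwise. For $0\le a<b\le n$, $\beta_{(a,b)}=\beta_{(b,a)}=\alpha_a+\dots+\alpha_{b-1}$. $\delta_P\in\{0,1\}$ is the indicator of $P$. -}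

module Defs where

open import Data.Bool using (Bool; true; false; if_then_else_; _∧_)
open import Data.Nat as ℕ using (ℕ; NonZero; _%_)
import Data.Nat.Properties as ℕP
open import Data.Fin using (Fin; toℕ; _≟_)
open import Data.Integer as ℤ using (ℤ; +_; _-_; -_; _+_; _*_; _%ℕ_)
import Data.Integer.Properties as ℤP
open import Data.List using (List; []; _∷_; foldr; map; allFin)
open import Data.List.Relation.Binary.Permutation.Propositional using (_↭_)
open import Relation.Nullary using (does)
open import Function using (_∘_; id)

module _ (n : ℕ) .{{_ : NonZero n}} where

  -- The simple generator s_i of the affine symmetric group, as a map ℤ → ℤ:
  -- it exchanges i + m n and i + 1 + m n for every m ∈ ℤ.
  sGen : Fin n → ℤ → ℤ
  sGen i x =
    if does ((x %ℕ n) ℕ.≟ toℕ i) then x + ℤ.1ℤ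
    else if does ((x %ℕ n) ℕ.≟ (ℕ.suc (toℕ i) % n)) then x - ℤ.1ℤ
    else x

  -- The element s_{a₁} s_{a₂} ⋯ s_{a_k} for the word [a₁, …, a_k], acting on ℤ
  -- (composition of maps: the rightmost letter acts first).
  wordElt : List (Fin n) → ℤ → ℤ
  wordElt = foldr (λ a f → sGen a ∘ f) id

  IsCoxeterWord : List (Fin n) → Set
  IsCoxeterWord w = w ↭ allFin n

  before : List (Fin n) → Fin n → Fin n → Bool
  before [] a b = false
  before (x ∷ xs) a b =
    if does (x ≟ a) then true else if does (x ≟ b) then false else before xs a b

  orderSign : List (Fin n) → Fin n → Fin n → ℤ
  orderSign w a b = if before w a b then ℤ.1ℤ else ℤ.-1ℤ

  -- Vectors of V = ℤ-span of α_0, …, α_{n-1}, given by coordinates.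
  V : Set
  V = Fin n → ℤ

  -- ω_c(α_a, α_b): a contribution ±1 for each of the relations
  -- b ≡ a + 1 and b ≡ a - 1 (mod n) (for n = 2 both hold, giving ±2).
  omegaBasis : List (Fin n) → Fin n → Fin n → ℤ
  omegaBasis w a b =
    (if does (toℕ b ℕ.≟ (ℕ.suc (toℕ a) % n)) then orderSign w a b else ℤ.0ℤ)
    + (if does (toℕ a ℕ.≟ (ℕ.suc (toℕ b) % n)) then orderSign w a b else ℤ.0ℤ)

  sumℤ : List ℤ → ℤ
  sumℤ = foldr _+_ ℤ.0ℤ

  omega : List (Fin n) → V → V → ℤ
  omega w u v =
    sumℤ (map (λ a → sumℤ (map (λ b → u a * v b * omegaBasis w a b) (allFin n))) (allFin n))

  deltaV : V
  deltaV _ = ℤ.1ℤ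

  beta : Fin n → Fin n → V
  beta i j k =
    if does (ℕ._≤?_ (toℕ i ℕ.⊓ toℕ j) (toℕ k)) ∧ does (ℕ._<?_ (toℕ k) (toℕ i ℕ.⊔ toℕ j))
    then ℤ.1ℤ else ℤ.0ℤ

  -- Indicator of x ∈ R̄_c = {x ∈ ℤ : c(x) < x}.
  indR : (ℤ → ℤ) → ℤ → ℤ
  indR c x = if does (c x ℤP.<? x) then ℤ.1ℤ else ℤ.0ℤ

  signGt : Fin n → Fin n → ℤ
  signGt i j = if does (ℕ._<?_ (toℕ j) (toℕ i)) then ℤ.-1ℤ else ℤ.1ℤ

module Submission where

-- A simple reflection s_h moves y only when y ≡ h (one step up) or y ≡ h + 1 (one step
-- down) modulo n. Follow x through a word in which every generator occurs once: after
-- its first move x sits at the residue of a letter that has already acted, so no later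
-- letter can move it back, and c(x) < x exactly when s_{x-1} acts before s_x, i.e. when
-- s_x precedes s_{x-1} in the word. Hence ω_c(α_a, δ) = ω_c(α_a, α_{a+1}) + ω_c(α_a, α_{a-1})
-- = 2 (δ_{a ∈ R̄_c} - δ_{a+1 ∈ R̄_c}), and summing over min(i,j) ≤ a < max(i,j) telescopes.

open import Defs
open import Data.Bool using (Bool; true; false; if_then_else_; _∧_)
open import Data.Empty using (⊥-elim)
open import Data.Fin using (Fin; zero; suc; toℕ; fromℕ; fromℕ<; inject₁; _≟_; punchIn)
open import Data.Fin.Properties using (toℕ-injective; toℕ<n; toℕ-fromℕ; toℕ-fromℕ<; toℕ-inject₁; punchInᵢ≢i)
open import Data.Integer as ℤ using (ℤ; +_; _+_; _-_; _*_; _%ℕ_; _/ℕ_; 0ℤ; 1ℤ; -1ℤ)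
import Data.Integer.Properties as ℤP
open import Data.Integer.DivMod using (n%ℕd<d; a≡a%ℕn+[a/ℕn]*n)
open import Data.Integer.Tactic.RingSolver using (solve-∀)
open import Data.List using (List; []; _∷_; map; tabulate; allFin)
open import Data.List.Properties using (map-tabulate)
open import Data.List.Membership.Propositional using (_∈_; _∉_)
open import Data.List.Membership.Propositional.Properties using (∈-allFin)
open import Data.List.Relation.Unary.All as All using (All; _∷_)
open import Data.List.Relation.Unary.Any using (Any; here; there)
open import Data.List.Relation.Unary.Unique.Propositional using (Unique; []; _∷_)
open import Data.List.Relation.Unary.Unique.Propositional.Properties using (allFin⁺)
open import Data.List.Relation.Binary.Permutation.Propositional using (↭-sym; ↭⇒↭ₛ)
open import Data.List.Relation.Binary.Permutation.Propositional.Properties using (∈-resp-↭)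
import Data.List.Relation.Binary.Permutation.Setoid.Properties as Permutationₛ
open import Data.Nat as ℕ using (ℕ; zero; suc; NonZero; _%_; _≤_; _<_; _≤?_; _<?_; _⊓_; _⊔_; s≤s)
import Data.Nat.Properties as ℕP
open import Data.Nat.DivMod using (m%n<n; n%n≡0; m≡m%n+[m/n]*n; %-distribˡ-+; [m+n]%n≡m%n; m<n⇒m%n≡m)
open import Data.Product as Product using (_×_; _,_; proj₁; proj₂)
open import Data.Sum as Sum using (_⊎_; inj₁; inj₂)
open import Function using (_∘_)
open import Relation.Binary using (tri<; tri≈; tri>)
open import Relation.Binary.PropositionalEquality
  using (_≡_; _≢_; refl; sym; trans; cong; cong₂; subst; setoid; module ≡-Reasoning)
open import Relation.Nullary using (Dec; yes; no; does)
open import Relation.Nullary.Decidable using (dec-true; dec-false)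
open import Relation.Unary using (Decidable)
open import Algebra.Properties.AbelianGroup ℤP.+-0-abelianGroup using (∙-cancelʳ)
open import Algebra.Properties.Semiring.Sum ℤP.+-*-semiring
  using (sum-syntax; sum-cong-≗; ∑-distrib-+; *-distribˡ-sum; sum-remove; sum-replicate-zero)

-- Residues modulo n

module _ {n : ℕ} .{{_ : NonZero n}} where

  +r+q*n<+s+p*n : ∀ {r s q p} → r ℕ.< n → q ℤ.< p → + r + q * + n ℤ.< + s + p * + n
  +r+q*n<+s+p*n {r} {s} {q} {p} r<n q<p = begin-strict
    + r + q * + n         <⟨ ℤP.+-monoˡ-< (q * + n) (ℤ.+<+ r<n) ⟩
    + n + q * + n         ≡⟨ N+q*N≡[1+q]*N (+ n) q ⟩
    ℤ.suc q * + n         ≤⟨ ℤP.*-monoʳ-≤-nonNeg (+ n) (ℤP.i<j⇒suc[i]≤j q<p) ⟩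
    p * + n               ≤⟨ ℤP.i≤j+i (p * + n) (+ s) ⟩
    + s + p * + n         ∎
    where
    open ℤP.≤-Reasoning
    N+q*N≡[1+q]*N : ∀ N q → N + q * N ≡ (1ℤ + q) * N
    N+q*N≡[1+q]*N = solve-∀

  remainder-injective : ∀ {r s} q p → r ℕ.< n → s ℕ.< n → + r + q * + n ≡ + s + p * + n → r ≡ s
  remainder-injective q p r<n s<n eq with ℤP.<-cmp q p
  ... | tri< q<p _ _ = ⊥-elim (ℤP.<-irrefl eq (+r+q*n<+s+p*n r<n q<p))
  ... | tri> _ _ p<q = ⊥-elim (ℤP.<-irrefl (sym eq) (+r+q*n<+s+p*n s<n p<q))
  ... | tri≈ _ refl _ = ℤP.+-injective (∙-cancelʳ (q * + n) (+ _) (+ _) eq)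

  %ℕ-unique : ∀ {i r} q → r ℕ.< n → i ≡ + r + q * + n → i %ℕ n ≡ r
  %ℕ-unique {i} q r<n i≡r+qn =
    remainder-injective (i /ℕ n) q (n%ℕd<d i n) r<n (trans (sym (a≡a%ℕn+[a/ℕn]*n i n)) i≡r+qn)

  [i+1]%ℕn≡[1+i%ℕn]%n : ∀ i → (i + 1ℤ) %ℕ n ≡ suc (i %ℕ n) % n
  [i+1]%ℕn≡[1+i%ℕn]%n i = %ℕ-unique (+ (s′ ℕ./ n) + q) (m%n<n s′ n) (begin
    i + 1ℤ                                   ≡⟨ cong (_+ 1ℤ) (a≡a%ℕn+[a/ℕn]*n i n) ⟩
    + s + q * + n + 1ℤ                       ≡⟨ x+y+1≡[1+x]+y (+ s) (q * + n) ⟩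
    + s′ + q * + n                           ≡⟨ cong (λ k → + k + q * + n) (m≡m%n+[m/n]*n s′ n) ⟩
    + (s′ % n ℕ.+ s′ ℕ./ n ℕ.* n) + q * + n  ≡⟨ cong (_+ q * + n) (ℤP.pos-+ (s′ % n) _) ⟩
    + (s′ % n) + + (s′ ℕ./ n ℕ.* n) + q * + n ≡⟨ cong (λ k → + (s′ % n) + k + q * + n) (ℤP.pos-* (s′ ℕ./ n) n) ⟩
    + (s′ % n) + + (s′ ℕ./ n) * + n + q * + n ≡⟨ regroup (+ (s′ % n)) (+ (s′ ℕ./ n)) q (+ n) ⟩
    + (s′ % n) + (+ (s′ ℕ./ n) + q) * + n    ∎)
    where
    open ≡-Reasoning
    s s′ : ℕ
    s = i %ℕ n
    s′ = suc s
    q : ℤ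
    q = i /ℕ n
    x+y+1≡[1+x]+y : ∀ x y → x + y + 1ℤ ≡ (1ℤ + x) + y
    x+y+1≡[1+x]+y = solve-∀
    regroup : ∀ r d q N → r + d * N + q * N ≡ r + (d + q) * N
    regroup = solve-∀

  [pred[n]+[1+m]]%n≡m : ∀ {m} → m ℕ.< n → (ℕ.pred n ℕ.+ suc m) % n ≡ m
  [pred[n]+[1+m]]%n≡m {m} m<n = begin
    (ℕ.pred n ℕ.+ suc m) % n   ≡⟨ cong (_% n) (ℕP.+-suc (ℕ.pred n) m) ⟩
    (suc (ℕ.pred n) ℕ.+ m) % n ≡⟨ cong (λ k → (k ℕ.+ m) % n) (ℕP.suc-pred n) ⟩
    (n ℕ.+ m) % n              ≡⟨ cong (_% n) (ℕP.+-comm n m) ⟩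
    (m ℕ.+ n) % n              ≡⟨ [m+n]%n≡m%n m n ⟩
    m % n                      ≡⟨ m<n⇒m%n≡m m<n ⟩
    m                          ∎
    where open ≡-Reasoning

  [1+m]%n-injective : ∀ {m o} → m ℕ.< n → o ℕ.< n → suc m % n ≡ suc o % n → m ≡ o
  [1+m]%n-injective {m} {o} m<n o<n eq = begin
    m                                           ≡⟨ [pred[n]+[1+m]]%n≡m m<n ⟨
    (ℕ.pred n ℕ.+ suc m) % n                    ≡⟨ %-distribˡ-+ (ℕ.pred n) (suc m) n ⟩
    (ℕ.pred n % n ℕ.+ suc m % n) % n            ≡⟨ cong (λ k → (ℕ.pred n % n ℕ.+ k) % n) eq ⟩
    (ℕ.pred n % n ℕ.+ suc o % n) % n            ≡⟨ %-distribˡ-+ (ℕ.pred n) (suc o) n ⟨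
    (ℕ.pred n ℕ.+ suc o) % n                    ≡⟨ [pred[n]+[1+m]]%n≡m o<n ⟩
    o                                           ∎
    where open ≡-Reasoning

  [i-1]%ℕn≡m : ∀ i {m} → m ℕ.< n → i %ℕ n ≡ suc m % n → (i - 1ℤ) %ℕ n ≡ m
  [i-1]%ℕn≡m i m<n eq = [1+m]%n-injective (n%ℕd<d (i - 1ℤ) n) m<n (begin
    suc ((i - 1ℤ) %ℕ n) % n ≡⟨ [i+1]%ℕn≡[1+i%ℕn]%n (i - 1ℤ) ⟨
    (i - 1ℤ + 1ℤ) %ℕ n      ≡⟨ cong (_%ℕ n) (i-1+1≡i i) ⟩
    i %ℕ n                  ≡⟨ eq ⟩
    _                       ∎)
    where
    open ≡-Reasoning
    i-1+1≡i : ∀ i → i - 1ℤ + 1ℤ ≡ i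
    i-1+1≡i = solve-∀

[1+m]%n≢m : ∀ {k m} → m ℕ.< suc (suc k) → suc m % suc (suc k) ≢ m
[1+m]%n≢m {k} m<n with ℕP.m≤n⇒m<n∨m≡n m<n
... | inj₁ 1+m<n = λ eq → ℕP.1+n≢n (trans (sym (m<n⇒m%n≡m 1+m<n)) eq)
... | inj₂ refl = λ eq → ℕP.0≢1+n (trans (sym (n%n≡0 (suc (suc k)))) eq)

i<i+1 : ∀ i → i ℤ.< i + 1ℤ
i<i+1 i = ℤP.suc[i]≤j⇒i<j (ℤP.≤-reflexive (ℤP.+-comm 1ℤ i))

i-1<i : ∀ i → i - 1ℤ ℤ.< i
i-1<i i = ℤP.i≤pred[j]⇒i<j (ℤP.≤-reflexive (ℤP.+-comm i -1ℤ))

-- Words of simple reflections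

module _ {n : ℕ} .{{_ : NonZero n}} where

  data Move (h : Fin n) (y : ℤ) : ℤ → Set where
    up   : y %ℕ n ≡ toℕ h → Move h y (y + 1ℤ)
    down : y %ℕ n ≡ suc (toℕ h) % n → Move h y (y - 1ℤ)
    stay : y %ℕ n ≢ toℕ h → y %ℕ n ≢ suc (toℕ h) % n → Move h y y

  sGen-move : ∀ h y → Move h y (sGen n h y)
  sGen-move h y = classify (y %ℕ n ℕ.≟ toℕ h) (y %ℕ n ℕ.≟ suc (toℕ h) % n) refl
    where
    classify : (p : Dec (y %ℕ n ≡ toℕ h)) (q : Dec (y %ℕ n ≡ suc (toℕ h) % n)) →
      sGen n h y ≡ (if does p then y + 1ℤ else if does q then y - 1ℤ else y) → Move h y (sGen n h y)
    classify (yes p) _       e = subst (Move h y) (sym e) (up p)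
    classify (no _)  (yes q) e = subst (Move h y) (sym e) (down q)
    classify (no ¬p) (no ¬q) e = subst (Move h y) (sym e) (stay ¬p ¬q)

  before-head : ∀ a b t → before n (a ∷ t) a b ≡ true
  before-head a b t with a ≟ a
  ... | yes _   = refl
  ... | no a≢a = ⊥-elim (a≢a refl)

  before-tail : ∀ {h a b} t → h ≢ a → h ≢ b → before n (h ∷ t) a b ≡ before n t a b
  before-tail {h} {a} {b} t h≢a h≢b with h ≟ a | h ≟ b
  ... | yes h≡a | _       = ⊥-elim (h≢a h≡a)
  ... | no _    | yes h≡b = ⊥-elim (h≢b h≡b)
  ... | no _    | no _    = refl

  before-asym : ∀ w {a b} → a ≢ b → before n w a b ≡ true → before n w b a ≡ false
  before-asym (h ∷ t) {a} {b} a≢b ab with h ≟ a | h ≟ b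
  ... | yes refl | yes refl = ⊥-elim (a≢b refl)
  ... | yes refl | no _     = refl
  ... | no _     | no _     = before-asym t a≢b ab
  before-asym (h ∷ t) a≢b () | no _ | yes _

  before-∷ : ∀ {h t a b} → All (h ≢_) t → b ∈ t → (a ∈ t → before n t a b ≡ true) →
    a ∈ h ∷ t → before n (h ∷ t) a b ≡ true
  before-∷ {t = t} {a} {b} h∉t b∈t ab (here refl) = before-head a b t
  before-∷ {t = t} h∉t b∈t ab (there a∈t) =
    trans (before-tail t (All.lookup h∉t a∈t) (All.lookup h∉t b∈t)) (ab a∈t)

  label-fresh : ∀ {f : Fin n → ℕ} {h t k} → (∀ {c d} → f c ≡ f d → c ≡ d) →
    All (h ≢_) t → Any (λ c → f c ≡ k) t → f h ≢ k
  label-fresh f-inj (h≢c ∷ _)   (here fc≡k) fh≡k = h≢c (f-inj (trans fh≡k (sym fc≡k)))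
  label-fresh f-inj (_   ∷ h∉t) (there p)   fh≡k = label-fresh f-inj h∉t p fh≡k

  [1+toℕ]%n-injective : ∀ {c d : Fin n} → suc (toℕ c) % n ≡ suc (toℕ d) % n → c ≡ d
  [1+toℕ]%n-injective {c} {d} eq = toℕ-injective ([1+m]%n-injective (toℕ<n c) (toℕ<n d) eq)

  -- The orbit of x under the letters of w, applied right to left; s_a and s_b are the
  -- letters moving x up and down. Once x has moved, its residue is the label of a letter
  -- already applied, and a unique word never reuses a letter, so the motion is monotone.
  data Trajectory (w : List (Fin n)) (x : ℤ) (a b : Fin n) : ℤ → Set where
    fixed     : a ∉ w → b ∉ w → Trajectory w x a b x
    descended : ∀ {z} → z ℤ.< x → Any (λ c → toℕ c ≡ z %ℕ n) w →
                b ∈ w → (a ∈ w → before n w a b ≡ true) → Trajectory w x a b z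
    ascended  : ∀ {z} → x ℤ.< z → Any (λ c → suc (toℕ c) % n ≡ z %ℕ n) w →
                a ∈ w → (b ∈ w → before n w b a ≡ true) → Trajectory w x a b z

  trajectory-∷ : ∀ {h t x a b y z} → All (h ≢_) t →
    toℕ a ≡ x %ℕ n → suc (toℕ b) % n ≡ x %ℕ n →
    Trajectory t x a b y → Move h y z → Trajectory (h ∷ t) x a b z
  trajectory-∷ {t = t} {x} {a} {b} _ ra _ (fixed _ b∉t) (up p)
    with refl ← toℕ-injective (trans (sym p) (sym ra)) =
    ascended (i<i+1 x) (here (sym (trans ([i+1]%ℕn≡[1+i%ℕn]%n x) (cong (λ r → suc r % n) p))))
      (here refl) λ { (here refl) → before-head b a t ; (there b∈t) → ⊥-elim (b∉t b∈t) }
  trajectory-∷ {h} {t} {x} {a} {b} _ _ rb (fixed a∉t _) (down q)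
    with refl ← [1+toℕ]%n-injective (trans (sym q) (sym rb)) =
    descended (i-1<i x) (here (sym ([i-1]%ℕn≡m x (toℕ<n h) q)))
      (here refl) λ { (here refl) → before-head a b t ; (there a∈t) → ⊥-elim (a∉t a∈t) }
  trajectory-∷ _ ra rb (fixed a∉t b∉t) (stay ¬p ¬q) =
    fixed (λ { (here refl) → ¬p (sym ra) ; (there a∈t) → a∉t a∈t })
          (λ { (here refl) → ¬q (sym rb) ; (there b∈t) → b∉t b∈t })
  trajectory-∷ h∉t _ _ (descended _ lbl _ _) (up p) =
    ⊥-elim (label-fresh toℕ-injective h∉t lbl (sym p))
  trajectory-∷ {h} {y = y} h∉t _ _ (descended y<x _ b∈t ab) (down q) =
    descended (ℤP.<-trans (i-1<i y) y<x) (here (sym ([i-1]%ℕn≡m y (toℕ<n h) q)))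
      (there b∈t) (before-∷ h∉t b∈t ab)
  trajectory-∷ h∉t _ _ (descended y<x lbl b∈t ab) (stay _ _) =
    descended y<x (there lbl) (there b∈t) (before-∷ h∉t b∈t ab)
  trajectory-∷ {y = y} h∉t _ _ (ascended x<y _ a∈t ba) (up p) =
    ascended (ℤP.<-trans x<y (i<i+1 y))
      (here (sym (trans ([i+1]%ℕn≡[1+i%ℕn]%n y) (cong (λ r → suc r % n) p))))
      (there a∈t) (before-∷ h∉t a∈t ba)
  trajectory-∷ h∉t _ _ (ascended _ lbl _ _) (down q) =
    ⊥-elim (label-fresh [1+toℕ]%n-injective h∉t lbl (sym q))
  trajectory-∷ h∉t _ _ (ascended x<y lbl a∈t ba) (stay _ _) =
    ascended x<y (there lbl) (there a∈t) (before-∷ h∉t a∈t ba)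

  trajectory : ∀ {w x a b} → Unique w → toℕ a ≡ x %ℕ n → suc (toℕ b) % n ≡ x %ℕ n →
    Trajectory w x a b (wordElt n w x)
  trajectory {[]}    []           ra rb = fixed (λ ()) (λ ())
  trajectory {h ∷ t} (h∉t ∷ uniq) ra rb =
    trajectory-∷ h∉t ra rb (trajectory uniq ra rb) (sGen-move h _)

  descent-dichotomy : ∀ {w x a b} → Unique w → a ∈ w → b ∈ w → a ≢ b →
    toℕ a ≡ x %ℕ n → suc (toℕ b) % n ≡ x %ℕ n →
      (wordElt n w x ℤ.< x × before n w a b ≡ true × before n w b a ≡ false)
    ⊎ (x ℤ.< wordElt n w x × before n w a b ≡ false × before n w b a ≡ true)
  descent-dichotomy {w} {x} uniq a∈w b∈w a≢b ra rb with wordElt n w x | trajectory {x = x} uniq ra rb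
  ... | _ | fixed a∉w _           = ⊥-elim (a∉w a∈w)
  ... | _ | descended z<x _ _ ab = inj₁ (z<x , ab a∈w , before-asym w a≢b (ab a∈w))
  ... | _ | ascended x<z _ _ ba  = inj₂ (x<z , before-asym w (a≢b ∘ sym) (ba b∈w) , ba b∈w)

  indR-< : ∀ {c : ℤ → ℤ} {x} → c x ℤ.< x → indR n c x ≡ 1ℤ
  indR-< {c} {x} cx<x = cong (if_then 1ℤ else 0ℤ) (dec-true (c x ℤP.<? x) cx<x)

  indR-> : ∀ {c : ℤ → ℤ} {x} → x ℤ.< c x → indR n c x ≡ 0ℤ
  indR-> {c} {x} x<cx = cong (if_then 1ℤ else 0ℤ) (dec-false (c x ℤP.<? x) (ℤP.<-asym x<cx))

-- Finite sums

module _ {n : ℕ} .{{_ : NonZero n}} where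

  sumℤ-tabulate : ∀ {k} (f : Fin k → ℤ) → sumℤ n (tabulate f) ≡ ∑[ a < k ] f a
  sumℤ-tabulate {zero}  f = refl
  sumℤ-tabulate {suc k} f = cong (_+_ (f zero)) (sumℤ-tabulate (f ∘ suc))

  sumℤ-allFin : ∀ (f : Fin n → ℤ) → sumℤ n (map f (allFin n)) ≡ ∑[ a < n ] f a
  sumℤ-allFin f = trans (cong (sumℤ n) (map-tabulate (λ a → a) f)) (sumℤ-tabulate f)

  omega-δ : ∀ w (u : V n) → omega n w u (deltaV n) ≡ ∑[ a < n ] (u a * ∑[ b < n ] omegaBasis n w a b)
  omega-δ w u = begin
    omega n w u (deltaV n)
      ≡⟨ sumℤ-allFin _ ⟩
    ∑[ a < n ] sumℤ n (map (λ b → u a * 1ℤ * omegaBasis n w a b) (allFin n))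
      ≡⟨ sum-cong-≗ (λ a → trans (sumℤ-allFin _) (sum-cong-≗ (λ b → cong (_* omegaBasis n w a b) (ℤP.*-identityʳ (u a))))) ⟩
    ∑[ a < n ] ∑[ b < n ] (u a * omegaBasis n w a b)
      ≡⟨ sum-cong-≗ (λ a → sym (*-distribˡ-sum (u a) (omegaBasis n w a))) ⟩
    ∑[ a < n ] (u a * ∑[ b < n ] omegaBasis n w a b)
      ∎
    where open ≡-Reasoning

∑-δ : ∀ {k} {P : Fin (suc k) → Set} (P? : Decidable P) (g : Fin (suc k) → ℤ) {b₀} →
  P b₀ → (∀ {b} → P b → b ≡ b₀) → ∑[ b < suc k ] (if does (P? b) then g b else 0ℤ) ≡ g b₀
∑-δ {k} P? g {b₀} Pb₀ unique = begin
  ∑[ b < suc k ] t b                       ≡⟨ sum-remove {i = b₀} t ⟩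
  t b₀ + ∑[ j < k ] t (punchIn b₀ j)       ≡⟨ cong₂ _+_ t[b₀]≡g[b₀] (trans (sum-cong-≗ t∘punchIn≡0) (sum-replicate-zero k)) ⟩
  g b₀ + 0ℤ                                ≡⟨ ℤP.+-identityʳ (g b₀) ⟩
  g b₀                                     ∎
  where
  open ≡-Reasoning
  t : Fin (suc k) → ℤ
  t b = if does (P? b) then g b else 0ℤ
  t[b₀]≡g[b₀] : t b₀ ≡ g b₀
  t[b₀]≡g[b₀] = cong (if_then g b₀ else 0ℤ) (dec-true (P? b₀) Pb₀)
  t∘punchIn≡0 : ∀ j → t (punchIn b₀ j) ≡ 0ℤ
  t∘punchIn≡0 j = cong (if_then _ else 0ℤ) (dec-false (P? _) (punchInᵢ≢i b₀ j ∘ unique))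

telescope : ∀ N (f : ℕ → ℤ) → ∑[ a < N ] (f (toℕ a) - f (suc (toℕ a))) ≡ f 0 - f N
telescope zero    f = sym (ℤP.+-inverseʳ (f 0))
telescope (suc N) f = begin
  f 0 - f 1 + ∑[ a < N ] (f (suc (toℕ a)) - f (suc (suc (toℕ a))))
    ≡⟨ cong (_+_ (f 0 - f 1)) (telescope N (f ∘ suc)) ⟩
  f 0 - f 1 + (f 1 - f (suc N))
    ≡⟨ x-y+[y-z]≡x-z (f 0) (f 1) (f (suc N)) ⟩
  f 0 - f (suc N)
    ∎
  where
  open ≡-Reasoning
  x-y+[y-z]≡x-z : ∀ x y z → x - y + (y - z) ≡ x - z
  x-y+[y-z]≡x-z = solve-∀

-- beta n i j a unfolds to 𝟙 (toℕ i ⊓ toℕ j ≤? toℕ a) (toℕ a <? toℕ i ⊔ toℕ j).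
𝟙 : ∀ {A B : Set} → Dec A → Dec B → ℤ
𝟙 p q = if does p ∧ does q then 1ℤ else 0ℤ

-- With clamp k = lo ⊔ (k ⊓ hi), the indicator-weighted difference is a difference of
-- f ∘ clamp, so ∑-interval telescopes; inside [lo, hi) the cyclic successor never wraps.
clamp-step : ∀ (f : ℕ → ℤ) {N lo hi k} .{{_ : NonZero N}} → hi < N → (p : Dec (lo ≤ k)) (q : Dec (k < hi)) →
  𝟙 p q * (f k - f (suc k % N)) ≡ f (lo ⊔ (k ⊓ hi)) - f (lo ⊔ (suc k ⊓ hi))
clamp-step f {N} {lo} {hi} {k} hi<N (yes lo≤k) (yes k<hi) = begin
  1ℤ * (f k - f (suc k % N))            ≡⟨ ℤP.*-identityˡ _ ⟩
  f k - f (suc k % N)                   ≡⟨ cong (λ v → f k - f v) (m<n⇒m%n≡m (ℕP.≤-<-trans k<hi hi<N)) ⟩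
  f k - f (suc k)                       ≡⟨ cong₂ (λ u v → f u - f v) (sym clamp[k]) (sym clamp[1+k]) ⟩
  f (lo ⊔ (k ⊓ hi)) - f (lo ⊔ (suc k ⊓ hi)) ∎
  where
  open ≡-Reasoning
  clamp[k] : lo ⊔ (k ⊓ hi) ≡ k
  clamp[k] = trans (cong (lo ⊔_) (ℕP.m≤n⇒m⊓n≡m (ℕP.<⇒≤ k<hi))) (ℕP.m≤n⇒m⊔n≡n lo≤k)
  clamp[1+k] : lo ⊔ (suc k ⊓ hi) ≡ suc k
  clamp[1+k] = trans (cong (lo ⊔_) (ℕP.m≤n⇒m⊓n≡m k<hi)) (ℕP.m≤n⇒m⊔n≡n (ℕP.m≤n⇒m≤1+n lo≤k))
clamp-step f {lo = lo} {hi} {k} _ (yes _) (no k≮hi) =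
  sym (trans (cong₂ (λ u v → f (lo ⊔ u) - f (lo ⊔ v)) (ℕP.m≥n⇒m⊓n≡n hi≤k) (ℕP.m≥n⇒m⊓n≡n (ℕP.m≤n⇒m≤1+n hi≤k)))
             (ℤP.+-inverseʳ (f (lo ⊔ hi))))
  where
  hi≤k : hi ≤ k
  hi≤k = ℕP.≮⇒≥ k≮hi
clamp-step f {lo = lo} {hi} {k} _ (no lo≰k) _ =
  sym (trans (cong₂ (λ u v → f u - f v) (ℕP.m≥n⇒m⊔n≡m (ℕP.≤-trans (ℕP.m⊓n≤m k hi) (ℕP.<⇒≤ k<lo)))
                                          (ℕP.m≥n⇒m⊔n≡m (ℕP.≤-trans (ℕP.m⊓n≤m (suc k) hi) k<lo)))
             (ℤP.+-inverseʳ (f lo)))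
  where
  k<lo : k < lo
  k<lo = ℕP.≰⇒> lo≰k

∑-interval : ∀ {N} .{{_ : NonZero N}} (f : ℕ → ℤ) {lo hi} → lo ≤ hi → hi < N →
  ∑[ a < N ] (𝟙 (lo ≤? toℕ a) (toℕ a <? hi) * (f (toℕ a) - f (suc (toℕ a) % N))) ≡ f lo - f hi
∑-interval {N} f {lo} {hi} lo≤hi hi<N = begin
  ∑[ a < N ] (𝟙 (lo ≤? toℕ a) (toℕ a <? hi) * (f (toℕ a) - f (suc (toℕ a) % N)))
    ≡⟨ sum-cong-≗ {N} (λ a → clamp-step f hi<N (lo ≤? toℕ a) (toℕ a <? hi)) ⟩
  ∑[ a < N ] (F (toℕ a) - F (suc (toℕ a)))
    ≡⟨ telescope N F ⟩
  F 0 - F N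
    ≡⟨ cong₂ (λ u v → f u - f v) (ℕP.⊔-identityʳ lo)
             (trans (cong (lo ⊔_) (ℕP.m≥n⇒m⊓n≡n (ℕP.<⇒≤ hi<N))) (ℕP.m≤n⇒m⊔n≡n lo≤hi)) ⟩
  f lo - f hi
    ∎
  where
  open ≡-Reasoning
  F : ℕ → ℤ
  F i = f (lo ⊔ (i ⊓ hi))

min-max-sign : ∀ (J : ℕ → ℤ) i j (d : Dec (j < i)) →
  + 2 * J (i ⊓ j) - + 2 * J (i ⊔ j) ≡ + 2 * (if does d then -1ℤ else 1ℤ) * (J i - J j)
min-max-sign J i j (yes j<i)
  rewrite ℕP.m≥n⇒m⊓n≡n (ℕP.<⇒≤ j<i) | ℕP.m≥n⇒m⊔n≡m (ℕP.<⇒≤ j<i) = swap (J i) (J j)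
  where
  swap : ∀ x y → + 2 * y - + 2 * x ≡ + 2 * -1ℤ * (x - y)
  swap = solve-∀
min-max-sign J i j (no j≮i)
  rewrite ℕP.m≤n⇒m⊓n≡m (ℕP.≮⇒≥ j≮i) | ℕP.m≤n⇒m⊔n≡n (ℕP.≮⇒≥ j≮i) = keep (J i) (J j)
  where
  keep : ∀ x y → + 2 * x - + 2 * y ≡ + 2 * 1ℤ * (x - y)
  keep = solve-∀

module _ {k : ℕ} where

  next : Fin (suc k) → Fin (suc k)
  next a = fromℕ< (m%n<n (suc (toℕ a)) (suc k))

  toℕ-next : ∀ a → toℕ (next a) ≡ suc (toℕ a) % suc k
  toℕ-next a = toℕ-fromℕ< _

  prev : Fin (suc k) → Fin (suc k)
  prev zero    = fromℕ k
  prev (suc a) = inject₁ a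

  [1+prev[a]]%n≡a : ∀ a → suc (toℕ (prev a)) % suc k ≡ toℕ a
  [1+prev[a]]%n≡a zero    = trans (cong (λ i → suc i % suc k) (toℕ-fromℕ k)) (n%n≡0 (suc k))
  [1+prev[a]]%n≡a (suc a) = trans (cong (λ i → suc i % suc k) (toℕ-inject₁ a)) (m<n⇒m%n≡m (toℕ<n (suc a)))

  row-sum : ∀ w a → ∑[ b < suc k ] omegaBasis (suc k) w a b
                    ≡ orderSign (suc k) w a (next a) + orderSign (suc k) w a (prev a)
  row-sum w a = begin
    ∑[ b < suc k ] (X b + Y b)                          ≡⟨ ∑-distrib-+ X Y ⟩
    ∑[ b < suc k ] X b + ∑[ b < suc k ] Y b             ≡⟨ cong₂ _+_ ∑X ∑Y ⟩
    orderSign (suc k) w a (next a) + orderSign (suc k) w a (prev a) ∎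
    where
    open ≡-Reasoning
    X Y : Fin (suc k) → ℤ
    X b = if does (toℕ b ℕ.≟ suc (toℕ a) % suc k) then orderSign (suc k) w a b else 0ℤ
    Y b = if does (toℕ a ℕ.≟ suc (toℕ b) % suc k) then orderSign (suc k) w a b else 0ℤ
    ∑X : ∑[ b < suc k ] X b ≡ orderSign (suc k) w a (next a)
    ∑X = ∑-δ (λ b → toℕ b ℕ.≟ suc (toℕ a) % suc k) (orderSign (suc k) w a) (toℕ-next a)
           (λ e → toℕ-injective (trans e (sym (toℕ-next a))))
    ∑Y : ∑[ b < suc k ] Y b ≡ orderSign (suc k) w a (prev a)
    ∑Y = ∑-δ (λ b → toℕ a ℕ.≟ suc (toℕ b) % suc k) (orderSign (suc k) w a) (sym ([1+prev[a]]%n≡a a))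
           (λ e → [1+toℕ]%n-injective (trans (sym e) (sym ([1+prev[a]]%n≡a a))))

-- The form ω_c on a Coxeter word

signs-of-indicator : ∀ {I : ℤ} {β β′ : Bool} →
    (I ≡ 1ℤ × β ≡ true × β′ ≡ false) ⊎ (I ≡ 0ℤ × β ≡ false × β′ ≡ true) →
    (if β then 1ℤ else -1ℤ) ≡ + 2 * I - 1ℤ × (if β′ then 1ℤ else -1ℤ) ≡ 1ℤ - + 2 * I
signs-of-indicator (inj₁ (refl , refl , refl)) = refl , refl
signs-of-indicator (inj₂ (refl , refl , refl)) = refl , refl

module _ {m : ℕ} where
  private
    n : ℕ
    n = suc (suc m)

  coxeter-unique : ∀ {w} → IsCoxeterWord n w → Unique w
  coxeter-unique cox = Permutationₛ.Unique-resp-↭ (setoid (Fin n)) (↭⇒↭ₛ (↭-sym cox)) (allFin⁺ n)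

  coxeter-∈ : ∀ {w} → IsCoxeterWord n w → ∀ a → a ∈ w
  coxeter-∈ cox a = ∈-resp-↭ (↭-sym cox) (∈-allFin a)

  orderSign-indR : ∀ {w a b} → IsCoxeterWord n w → suc (toℕ b) % n ≡ toℕ a →
      orderSign n w a b ≡ + 2 * indR n (wordElt n w) (+ toℕ a) - 1ℤ
    × orderSign n w b a ≡ 1ℤ - + 2 * indR n (wordElt n w) (+ toℕ a)
  orderSign-indR {w} {a} {b} cox [1+b]%n≡a = signs-of-indicator
    (Sum.map (Product.map₁ (indR-< {n = n} {wordElt n w})) (Product.map₁ (indR-> {n = n} {wordElt n w}))
      (descent-dichotomy (coxeter-unique cox) (coxeter-∈ cox a) (coxeter-∈ cox b) a≢b ra rb))
    where
    a≢b : a ≢ b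
    a≢b refl = [1+m]%n≢m (toℕ<n a) [1+b]%n≡a
    ra : toℕ a ≡ (+ toℕ a) %ℕ n
    ra = sym (m<n⇒m%n≡m (toℕ<n a))
    rb : suc (toℕ b) % n ≡ (+ toℕ a) %ℕ n
    rb = trans [1+b]%n≡a ra

  row-sum-coxeter : ∀ {w} → IsCoxeterWord n w → ∀ a →
    ∑[ b < n ] omegaBasis n w a b
      ≡ + 2 * indR n (wordElt n w) (+ toℕ a) - + 2 * indR n (wordElt n w) (+ (suc (toℕ a) % n))
  row-sum-coxeter {w} cox a = begin
    ∑[ b < n ] omegaBasis n w a b
      ≡⟨ row-sum w a ⟩
    orderSign n w a (next a) + orderSign n w a (prev a)
      ≡⟨ cong₂ _+_ (proj₂ (orderSign-indR cox (sym (toℕ-next a)))) (proj₁ (orderSign-indR cox ([1+prev[a]]%n≡a a))) ⟩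
    (1ℤ - + 2 * J (toℕ (next a))) + (+ 2 * J (toℕ a) - 1ℤ)
      ≡⟨ cong (λ i → (1ℤ - + 2 * J i) + (+ 2 * J (toℕ a) - 1ℤ)) (toℕ-next a) ⟩
    (1ℤ - + 2 * J (suc (toℕ a) % n)) + (+ 2 * J (toℕ a) - 1ℤ)
      ≡⟨ regroup (J (toℕ a)) (J (suc (toℕ a) % n)) ⟩
    + 2 * J (toℕ a) - + 2 * J (suc (toℕ a) % n)
      ∎
    where
    open ≡-Reasoning
    J : ℕ → ℤ
    J k = indR n (wordElt n w) (+ k)
    regroup : ∀ x y → (1ℤ - + 2 * y) + (+ 2 * x - 1ℤ) ≡ + 2 * x - + 2 * y
    regroup = solve-∀

lemma2p7 : (n : ℕ) .{{_ : NonZero n}} → 2 ≤ n →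
    (w : List (Fin n)) → IsCoxeterWord n w →
    (i j : Fin n) → i ≢ j →
    omega n w (beta n i j) (deltaV n)
      ≡ + 2 * signGt n i j
          * (indR n (wordElt n w) (+ toℕ i) - indR n (wordElt n w) (+ toℕ j))
lemma2p7 (suc (suc m)) _ w cox i j _ = begin
  omega n w (beta n i j) (deltaV n)
    ≡⟨ omega-δ w (beta n i j) ⟩
  ∑[ a < n ] (beta n i j a * ∑[ b < n ] omegaBasis n w a b)
    ≡⟨ sum-cong-≗ {n} (λ a → cong (beta n i j a *_) (row-sum-coxeter cox a)) ⟩
  ∑[ a < n ] (beta n i j a * (K (toℕ a) - K (suc (toℕ a) % n)))
    ≡⟨ ∑-interval K (ℕP.m⊓n≤m⊔n (toℕ i) (toℕ j)) (ℕP.⊔-lub (toℕ<n i) (toℕ<n j)) ⟩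
  K (toℕ i ⊓ toℕ j) - K (toℕ i ⊔ toℕ j)
    ≡⟨ min-max-sign J (toℕ i) (toℕ j) (toℕ j <? toℕ i) ⟩
  + 2 * signGt n i j * (J (toℕ i) - J (toℕ j))
    ∎
  where
  open ≡-Reasoning
  n : ℕ
  n = suc (suc m)
  J K : ℕ → ℤ
  J k = indR n (wordElt n w) (+ k)
  K k = + 2 * J k
lemma2p7 (suc zero) (s≤s ()) _ _ _ _ _
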